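{- For every instance of Unlabeled Pebble Motion on Trees on a tree $T=(V,E)$ with root $r$, the algorithm $\mathit{balance\_subtrees}(r)$ (described in the context) terminates and outputs a feasible plan whose length is $\sum_{u\in V}|d_0(u)|$, where $d_0$ is the demand function of the initial configuration; this length equals the minimum length $\mathit{OPT}$ of a feasible plan, i.e. $\mathit{OPT}=\sum_{u\in V}|d_0(u)|$.
   Context: Unlabeled Pebble Motion on Trees (UPMT): a tree $T=(V,E)$ with $n=|V|$ nodes; $k$ pebbles initially occupy $k$ distinct nodes; $k$ distinct nodes are targets (may coincide with starting nodes). A move moves one pebble to an adjacent pebble-free node; a plan is a sequence of moves; it is feasible if afterwards every pebble is on a target; its length is its number of moves; $\mathit{OPT}$ is the minimum length of a feasible plan. Fix a root $r$; $T_u$ is the subtree rooted at $u$; $p(u)\in\{0,1\}$ is the current number of pebbles on $u$, $\tau(u)\in\{0,1\}$ the number of targets at $u$, and the (current) demand is $d(u)=\sum_{v\in T_u}\tau(v)-\sum_{v\in T_u}p(v)$. The algorithm maintains $p$ and $d$ and uses: $\mathit{move\_pebble}(u,v)$ ($u,v$ adjacent): set $p(u)\gets0$, $p(v)\gets1$; if $v$ is a child of $u$ set $d(v)\gets d(v)-1$, otherwise set $d(u)\gets d(u)+1$; output the move $(u,v)$. $\mathit{inject\_pebble}(v)$ ($v\ne r$ with parent $u$): if $p(v)=1$, pick any child $w$ of $v$ with $d(w)>0$ and call $\mathit{inject\_pebble}(w)$; then call $\mathit{move\_pebble}(u,v)$. $\mathit{extract\_pebble}(v)$ ($v\neq r$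 with parent $u$): if $p(v)=0$, pick any child $w$ of $v$ with $d(w)<0$ and call $\mathit{extract\_pebble}(w)$; then call $\mathit{move\_pebble}(v,u)$. $\mathit{balance\_subtrees}(u)$: while some child $v$ of $u$ has $d(v)\neq0$: if $p(u)=1$, pick a child $v$ of $u$ with $d(v)>0$ and call $\mathit{inject\_pebble}(v)$; else pick a child $v$ of $u$ with $d(v)<0$ and call $\mathit{extract\_pebble}(v)$. After the while loop, call $\mathit{balance\_subtrees}(v)$ for each child $v$ of $u$. The algorithm first computes $d$ for the initial configuration and then calls $\mathit{balance\_subtrees}(r)$; its output plan is the sequence of output moves. -}

module Defs where

import Data.Nat
open import Data.Nat using (ℕ; zero; suc; _≤_; _<_)
open import Data.Integer as ℤ using (ℤ; +_; ∣_∣) renaming (_+_ to _+ℤ_; _-_ to _-ℤ_)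
import Data.Integer.Properties as ℤP
open import Data.Fin using (Fin; _≟_)
open import Data.List using (List; []; _∷_; _++_; [_]; length; map; foldr; allFin)
open import Data.Bool.ListAction using (any)
open import Data.Maybe using (Maybe; just; nothing; _>>=_)
open import Data.Bool using (Bool; true; false; if_then_else_; _∧_; _∨_; not)
open import Data.Product using (Σ; ∃; _×_; _,_)
open import Relation.Nullary.Decidable using (⌊_⌋)
open import Relation.Binary.PropositionalEquality using (_≡_)
open import Function.Bundles using (_⇔_)

-- A rooted tree on the vertex set Fin n, given by its parent function.
-- parent v ≡ nothing exactly for the root; the rank function witnesses
-- that following parents terminates (acyclicity), so every vertex is
-- connected to the root.  Every (finite, nonempty) tree with a chosen
-- root r arises in this way, and conversely.
record RootedTree (n : ℕ) : Set where
  field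
    root     : Fin n
    parent   : Fin n → Maybe (Fin n)
    isRoot   : ∀ v → (parent v ≡ nothing) ⇔ (v ≡ root)
    rank     : Fin n → ℕ
    rank-dec : ∀ u v → parent v ≡ just u → rank u < rank v

-- configurations (set of occupied nodes / set of target nodes)
Config : ℕ → Set
Config n = Fin n → Bool

Move : ℕ → Set
Move n = Fin n × Fin n

Plan : ℕ → Set
Plan n = List (Move n)

sumℕ : List ℕ → ℕ
sumℕ = foldr Data.Nat._+_ 0

sumℤ : List ℤ → ℤ
sumℤ = foldr _+ℤ_ (+ 0)

b2ℕ : Bool → ℕ
b2ℕ true  = 1
b2ℕ false = 0

count : ∀ {n} → Config n → ℕ
count {n} c = sumℕ (map (λ v → b2ℕ (c v)) (allFin n))

upd : ∀ {n} {A : Set} → (Fin n → A) → Fin n → A → Fin n → A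
upd f u a v = if ⌊ v ≟ u ⌋ then a else f v

module Tree {n : ℕ} (T : RootedTree n) where
  open RootedTree T

  isChild : Fin n → Fin n → Bool
  isChild u v with parent v
  ... | just w  = ⌊ w ≟ u ⌋
  ... | nothing = false

  adjacent : Fin n → Fin n → Bool
  adjacent u v = isChild u v ∨ isChild v u

  -- inSubtree u v : v ∈ T_u, i.e. u is v or an ancestor of v.
  -- Every node has depth < n, so n parent steps suffice.
  inSubAux : ℕ → Fin n → Fin n → Bool
  inSubAux zero    u v = ⌊ v ≟ u ⌋
  inSubAux (suc k) u v with ⌊ v ≟ u ⌋ | parent v
  ... | true  | _       = true
  ... | false | just w  = inSubAux k u w
  ... | false | nothing = false

  inSubtree : Fin n → Fin n → Bool
  inSubtree = inSubAux n

  validMove : Config n → Move n → Bool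
  validMove c (u , v) = adjacent u v ∧ c u ∧ not (c v)

  applyMove : Config n → Move n → Config n
  applyMove c (u , v) = upd (upd c u false) v true

  exec : Config n → Plan n → Maybe (Config n)
  exec c []       = just c
  exec c (m ∷ ms) = if validMove c m then exec (applyMove c m) ms else nothing

  Feasible : Config n → Config n → Plan n → Set
  Feasible p₀ τ plan =
    Σ (Config n) λ c → exec p₀ plan ≡ just c × (∀ v → c v ≡ true → τ v ≡ true)

  IsOPT : Config n → Config n → ℕ → Set
  IsOPT p₀ τ m =
    (Σ (Plan n) λ plan → Feasible p₀ τ plan × length plan ≡ m)
    × (∀ plan → Feasible p₀ τ plan → m ≤ length plan)

  b2ℤ : Bool → ℤ
  b2ℤ b = + b2ℕ b

  demand : Config n → Config n → Fin n → ℤ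
  demand p τ u =
    sumℤ (map (λ v → if inSubtree u v then b2ℤ (τ v) -ℤ b2ℤ (p v) else + 0) (allFin n))

  totalDemand : Config n → Config n → ℕ
  totalDemand p τ = sumℕ (map (λ u → ∣ demand p τ u ∣) (allFin n))

  -- Nondeterministic choices ("pick any child w with …")
  -- are resolved by a scheduler σ : ℕ → Fin n: the i-th choice made takes
  -- σ i if it is an admissible candidate, and otherwise the first admissible
  -- candidate.  Quantifying over all σ covers every possible run.
  -- Recursion is bounded by a fuel parameter; 'nothing' means the fuel ran
  -- out or the algorithm got stuck (no admissible candidate to pick).

  record St : Set where
    constructor st
    field
      pe  : Config n
      de  : Fin n → ℤ
      out : Plan n
      cnt : ℕ                 -- number of choices made so far
  open St

  Scheduler : Set
  Scheduler = ℕ → Fin n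

  firstSat : (Fin n → Bool) → List (Fin n) → Maybe (Fin n)
  firstSat c []       = nothing
  firstSat c (x ∷ xs) = if c x then just x else firstSat c xs

  pick : Scheduler → (Fin n → Bool) → St → Maybe (Fin n × St)
  pick σ c s with c (σ (cnt s)) | firstSat c (allFin n)
  ... | true  | _       = just (σ (cnt s) , record s { cnt = suc (cnt s) })
  ... | false | just w  = just (w , record s { cnt = suc (cnt s) })
  ... | false | nothing = nothing

  pos neg nz : ℤ → Bool
  pos x = ⌊ + 0 ℤ.<? x ⌋
  neg x = ⌊ x ℤ.<? + 0 ⌋
  nz  x = not ⌊ x ℤ.≟ + 0 ⌋

  movePebble : Fin n → Fin n → St → St
  movePebble u v s =
    st (upd (upd (pe s) u false) v true)
       (if isChild u v then upd (de s) v (de s v -ℤ + 1)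
                       else upd (de s) u (de s u +ℤ + 1))
       (out s ++ [ (u , v) ])
       (cnt s)

  inject : Scheduler → ℕ → Fin n → St → Maybe St
  inject σ zero    v s = nothing
  inject σ (suc f) v s with parent v
  ... | nothing = nothing
  ... | just u  =
    if pe s v
    then (pick σ (λ w → isChild v w ∧ pos (de s w)) s >>= λ where
            (w , s₁) → inject σ f w s₁ >>= λ s₂ → just (movePebble u v s₂))
    else just (movePebble u v s)

  extract : Scheduler → ℕ → Fin n → St → Maybe St
  extract σ zero    v s = nothing
  extract σ (suc f) v s with parent v
  ... | nothing = nothing
  ... | just u  =
    if not (pe s v)
    then (pick σ (λ w → isChild v w ∧ neg (de s w)) s >>= λ where
            (w , s₁) → extract σ f w s₁ >>= λ s₂ → just (movePebble v u s₂))
    else just (movePebble v u s)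

  balWhile : Scheduler → ℕ → Fin n → St → Maybe St
  balWhile σ zero    u s = nothing
  balWhile σ (suc f) u s =
    if any (λ v → isChild u v ∧ nz (de s v)) (allFin n)
    then (if pe s u
          then (pick σ (λ v → isChild u v ∧ pos (de s v)) s >>= λ where
                  (v , s₁) → inject σ f v s₁ >>= balWhile σ f u)
          else (pick σ (λ v → isChild u v ∧ neg (de s v)) s >>= λ where
                  (v , s₁) → extract σ f v s₁ >>= balWhile σ f u))
    else just s

  mutual
    balance : Scheduler → ℕ → Fin n → St → Maybe St
    balance σ zero    u s = nothing
    balance σ (suc f) u s = balWhile σ f u s >>= balChildren σ f u (λ _ → false)

    balChildren : Scheduler → ℕ → Fin n → Config n → St → Maybe St
    balChildren σ zero    u done s = nothing
    balChildren σ (suc f) u done s =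
      if any (λ v → isChild u v ∧ not (done v)) (allFin n)
      then (pick σ (λ v → isChild u v ∧ not (done v)) s >>= λ where
              (v , s₁) → balance σ f v s₁ >>= balChildren σ f u (upd done v true))
      else just s

  initSt : Config n → Config n → St
  initSt p τ = st p (demand p τ) [] 0

  run : Config n → Config n → Scheduler → ℕ → Maybe St
  run p τ σ fuel = balance σ fuel root (initSt p τ)

-- Write d for the current demand.  A move along the edge between v and its parent changes
-- d(v) by ±1 and no other demand (the root's demand in particular never changes), so
-- Σ_u |d(u)| drops by at most one per move.  A final configuration with all pebbles on
-- targets has every demand 0, hence OPT ≥ Σ_u |d₀(u)|.
--
-- Conversely every move of the algorithm lowers Σ_u |d(u)| by exactly one: a pebble enters
-- T_v only through inject_pebble(v), called when d(v) > 0, and leaves it only through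
-- extract_pebble(v), called when d(v) < 0.  The identity d(v) = τ(v) − p(v) + Σ_w d(w),
-- w ranging over the children of v, supplies a child of the required sign whenever the
-- recursion descends or the while loop looks for one.  When balance_subtrees(r) returns,
-- all demands are 0, which forces p = τ.  The recursions terminate because inject/extract
-- descend along root paths (of length < n), every pass of the while loop lowers Σ|d|, and
-- the loop over the children finishes one child per round.

module Submission where

open import Defs
open import Algebra.Bundles using (CommutativeMonoid)
open import Data.Bool using (Bool; true; false; if_then_else_; _∧_; _∨_; not)
open import Data.Bool.ListAction using (any)
open import Data.Bool.Properties using (T-≡)
open import Data.Empty using (⊥; ⊥-elim)
open import Data.Fin using (Fin; zero; suc; _≟_; punchIn)
import Data.Fin.Properties as FinP
open import Data.Integer as ℤ using (ℤ; +_; ∣_∣) renaming (_+_ to _+ℤ_; _-_ to _-ℤ_)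
import Data.Integer.Properties as ℤP
open import Data.Integer.Tactic.RingSolver using (solve-∀)
open import Data.List using ([]; _∷_; _++_; [_]; length; map; foldr; tabulate; allFin)
open import Data.List.Membership.Propositional using (_∈_; lose)
open import Data.List.Membership.Propositional.Properties using (∈-allFin)
open import Data.List.Properties using (map-tabulate; length-++)
open import Data.List.Relation.Unary.Any using (here; there; satisfied)
open import Data.List.Relation.Unary.Any.Properties using (any⁺; any⁻)
open import Data.Maybe using (Maybe; just; nothing; _>>=_)
open import Data.Maybe.Properties using (just-injective)
open import Data.Nat as ℕ using (ℕ; zero; suc; _+_; _≤_; _<_; _⊔_; s≤s)
open import Data.Nat.Induction using (<-wellFounded)
import Data.Nat.Properties as ℕP
open import Data.Product using (Σ; ∃; _×_; _,_; proj₁; proj₂)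
open import Data.Sum using (_⊎_; inj₁; inj₂)
import Data.Vec.Functional as Vector
open import Function using (_∘_; id; case_of_)
open import Function.Bundles using (Equivalence)
open import Induction.WellFounded using (Acc; acc)
open import Relation.Nullary using (¬_; Dec; yes; no)
open import Relation.Nullary.Decidable using (⌊_⌋)
open import Relation.Binary.PropositionalEquality hiding ([_])
open import Algebra.Properties.AbelianGroup ℤP.+-0-abelianGroup using (identityˡ-unique)

foldr-tabulate : ∀ {A B : Set} (f : A → B → B) e {m} (g : Fin m → A) →
                 foldr f e (tabulate g) ≡ Vector.foldr f e g
foldr-tabulate f e {zero}  g = refl
foldr-tabulate f e {suc m} g = cong (f (g zero)) (foldr-tabulate f e (g ∘ suc))

foldr-map-allFin : ∀ {A B : Set} (f : A → B → B) e {m} (g : Fin m → A) →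
                   foldr f e (map g (allFin m)) ≡ Vector.foldr f e g
foldr-map-allFin f e g = trans (cong (foldr f e) (map-tabulate id g)) (foldr-tabulate f e g)

module FinSum {c ℓ} (M : CommutativeMonoid c ℓ) where
  open CommutativeMonoid M
    using (Carrier; _≈_; _∙_; comm; assoc; ∙-congˡ; ∙-congʳ)
    renaming (sym to ≈-sym; setoid to ≈-setoid)
  open import Algebra.Properties.CommutativeMonoid.Sum M public
  open import Relation.Binary.Reasoning.Setoid ≈-setoid

  sum-except : ∀ {m} (f g : Fin m → Carrier) y → (∀ x → x ≢ y → f x ≈ g x) →
               sum f ∙ g y ≈ sum g ∙ f y
  sum-except {suc m} f g y f≈g = begin
    sum f ∙ g y                                ≈⟨ ∙-congʳ (sum-remove f) ⟩
    (f y ∙ sum (Vector.removeAt f y)) ∙ g y    ≈⟨ ∙-congʳ (∙-congˡ (sum-cong-≋ agree)) ⟩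
    (f y ∙ sum (Vector.removeAt g y)) ∙ g y    ≈⟨ swap (f y) _ (g y) ⟩
    (g y ∙ sum (Vector.removeAt g y)) ∙ f y    ≈⟨ ∙-congʳ (≈-sym (sum-remove g)) ⟩
    sum g ∙ f y                                ∎
    where
    agree : ∀ i → f (punchIn y i) ≈ g (punchIn y i)
    agree i = f≈g (punchIn y i) (FinP.punchInᵢ≢i y i)
    swap : ∀ a s b → (a ∙ s) ∙ b ≈ (b ∙ s) ∙ a
    swap a s b = begin
      (a ∙ s) ∙ b ≈⟨ comm _ b ⟩
      b ∙ (a ∙ s) ≈⟨ ∙-congˡ (comm a s) ⟩
      b ∙ (s ∙ a) ≈⟨ ≈-sym (assoc b s a) ⟩
      (b ∙ s) ∙ a ∎

module ℕ∑ = FinSum ℕP.+-0-commutativeMonoid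
module ℤ∑ = FinSum ℤP.+-0-commutativeMonoid

pos-sum : ∀ {m} (f : Fin m → ℕ) → + ℕ∑.sum f ≡ ℤ∑.sum (+_ ∘ f)
pos-sum {zero}  f = refl
pos-sum {suc m} f = trans (ℤP.pos-+ (f zero) _) (cong (+ f zero +ℤ_) (pos-sum (f ∘ suc)))

∑-mono-≤ : ∀ {m} {f g : Fin m → ℤ} → (∀ x → f x ℤ.≤ g x) → ℤ∑.sum f ℤ.≤ ℤ∑.sum g
∑-mono-≤ {zero}  f≤g = ℤP.≤-refl
∑-mono-≤ {suc m} f≤g = ℤP.+-mono-≤ (f≤g zero) (∑-mono-≤ (f≤g ∘ suc))

∑-mono-< : ∀ {m} {f g : Fin m → ℤ} → (∀ x → f x ℤ.≤ g x) → ∀ y → f y ℤ.< g y →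
           ℤ∑.sum f ℤ.< ℤ∑.sum g
∑-mono-< f≤g zero    f<g = ℤP.+-mono-<-≤ f<g (∑-mono-≤ (f≤g ∘ suc))
∑-mono-< f≤g (suc y) f<g = ℤP.+-mono-≤-< (f≤g zero) (∑-mono-< (f≤g ∘ suc) y f<g)

positive-summand : ∀ {m} (g : Fin m → ℤ) → ¬ (∀ x → g x ℤ.≤ + 0) → ∃ λ x → + 0 ℤ.< g x
positive-summand g not-all with FinP.any? (λ x → + 0 ℤ.<? g x)
... | yes found = found
... | no  none  = ⊥-elim (not-all (λ x → ℤP.≮⇒≥ (λ 0<gx → none (x , 0<gx))))

negative-summand : ∀ {m} (g : Fin m → ℤ) → ¬ (∀ x → + 0 ℤ.≤ g x) → ∃ λ x → g x ℤ.< + 0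
negative-summand g not-all with FinP.any? (λ x → g x ℤ.<? + 0)
... | yes found = found
... | no  none  = ⊥-elim (not-all (λ x → ℤP.≮⇒≥ (λ gx<0 → none (x , gx<0))))

∑-single : ∀ {m} (f : Fin m → ℤ) y → (∀ x → x ≢ y → f x ≡ + 0) → ℤ∑.sum f ≡ f y
∑-single {m} f y off-y = begin
  ℤ∑.sum f                          ≡⟨ ℤP.+-identityʳ _ ⟨
  ℤ∑.sum f +ℤ + 0                   ≡⟨ ℤ∑.sum-except f (λ _ → + 0) y off-y ⟩
  ℤ∑.sum {m} (λ _ → + 0) +ℤ f y     ≡⟨ cong (_+ℤ f y) (ℤ∑.sum-replicate-zero m) ⟩
  + 0 +ℤ f y                        ≡⟨ ℤP.+-identityˡ (f y) ⟩
  f y                               ∎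
  where open ≡-Reasoning

∑-nonpos : ∀ {m} {g : Fin m → ℤ} → (∀ x → g x ℤ.≤ + 0) → ℤ∑.sum g ℤ.≤ + 0
∑-nonpos {m} g≤0 = ℤP.≤-trans (∑-mono-≤ g≤0) (ℤP.≤-reflexive (ℤ∑.sum-replicate-zero m))

∑-nonneg : ∀ {m} {g : Fin m → ℤ} → (∀ x → + 0 ℤ.≤ g x) → + 0 ℤ.≤ ℤ∑.sum g
∑-nonneg {m} 0≤g = ℤP.≤-trans (ℤP.≤-reflexive (sym (ℤ∑.sum-replicate-zero m))) (∑-mono-≤ 0≤g)

∑-neg : ∀ {m} {g : Fin m → ℤ} → (∀ x → g x ℤ.≤ + 0) → ∀ y → g y ≢ + 0 → ℤ∑.sum g ℤ.< + 0
∑-neg {m} g≤0 y gy≢0 = ℤP.<-≤-trans (∑-mono-< g≤0 y (ℤP.≤∧≢⇒< (g≤0 y) gy≢0))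
                                    (ℤP.≤-reflexive (ℤ∑.sum-replicate-zero m))

∑-pos : ∀ {m} {g : Fin m → ℤ} → (∀ x → + 0 ℤ.≤ g x) → ∀ y → g y ≢ + 0 → + 0 ℤ.< ℤ∑.sum g
∑-pos {m} 0≤g y gy≢0 = ℤP.≤-<-trans (ℤP.≤-reflexive (sym (ℤ∑.sum-replicate-zero m)))
                                    (∑-mono-< 0≤g y (ℤP.≤∧≢⇒< (0≤g y) (gy≢0 ∘ sym)))

upd-same : ∀ {m} {A : Set} (f : Fin m → A) u a → upd f u a u ≡ a
upd-same f u a with u ≟ u
... | yes _   = refl
... | no u≢u = ⊥-elim (u≢u refl)

upd-other : ∀ {m} {A : Set} (f : Fin m → A) u a {v} → v ≢ u → upd f u a v ≡ f v
upd-other f u a {v} v≢u with v ≟ u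
... | yes v≡u = ⊥-elim (v≢u v≡u)
... | no _    = refl

upd-cong : ∀ {m} {A : Set} {f g : Fin m → A} v {a b} → (∀ x → f x ≡ g x) → a ≡ b →
           ∀ x → upd f v a x ≡ upd g v b x
upd-cong v f≗g a≡b x with x ≟ v
... | yes _ = a≡b
... | no  _ = f≗g x

⌊⌋-yes : ∀ {A : Set} (a? : Dec A) → A → ⌊ a? ⌋ ≡ true
⌊⌋-yes (yes _) _ = refl
⌊⌋-yes (no ¬a) a = ⊥-elim (¬a a)

⌊⌋-witness : ∀ {A : Set} (a? : Dec A) → ⌊ a? ⌋ ≡ true → A
⌊⌋-witness (yes a) _ = a

∧-elim : ∀ {a b} → a ∧ b ≡ true → a ≡ true × b ≡ true
∧-elim {true} b≡true = refl , b≡true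

∨-elim : ∀ {a b} → a ∨ b ≡ true → a ≡ true ⊎ b ≡ true
∨-elim {true}  _        = inj₁ refl
∨-elim {false} b≡true = inj₂ b≡true

not≡true : ∀ {b} → not b ≡ true → b ≡ false
not≡true {false} _ = refl

any-witness : ∀ {m} (q : Fin m → Bool) → any q (allFin m) ≡ true → ∃ λ x → q x ≡ true
any-witness {m} q h with satisfied (any⁻ q (allFin m) (Equivalence.from T-≡ h))
... | x , qx = x , Equivalence.to T-≡ qx

any-false : ∀ {m} (q : Fin m → Bool) → any q (allFin m) ≡ false → ∀ x → q x ≡ false
any-false q none x with q x in qx
... | false = refl
... | true  = case trans (sym none) (Equivalence.to T-≡ (any⁺ q
                     (lose (∈-allFin x) (Equivalence.from T-≡ qx)))) of λ ()

module Ancestry {n : ℕ} (T : RootedTree n) where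
  open RootedTree T
  open Tree T

  infix 4 _≼_

  data _≼_ (u : Fin n) : Fin n → Set where
    ≼-refl  : u ≼ u
    ≼-child : ∀ {v w} → parent v ≡ just w → u ≼ w → u ≼ v

  pathLength : ∀ {u v} → u ≼ v → ℕ
  pathLength ≼-refl        = 0
  pathLength (≼-child _ a) = suc (pathLength a)

  pathVertex : ∀ {u v} (a : u ≼ v) → Fin (suc (pathLength a)) → Fin n
  pathVertex {u} ≼-refl    zero    = u
  pathVertex {v = v} (≼-child _ a) zero = v
  pathVertex (≼-child _ a) (suc i) = pathVertex a i

  pathVertex-rank≤ : ∀ {u v} (a : u ≼ v) i → rank (pathVertex a i) ≤ rank v
  pathVertex-rank≤ ≼-refl        zero    = ℕP.≤-refl
  pathVertex-rank≤ (≼-child e a) zero    = ℕP.≤-refl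
  pathVertex-rank≤ (≼-child e a) (suc i) =
    ℕP.<⇒≤ (ℕP.≤-<-trans (pathVertex-rank≤ a i) (rank-dec _ _ e))

  pathVertex-rank-strict : ∀ {u v} (a : u ≼ v) {i j} → i Data.Fin.< j →
                           rank (pathVertex a j) < rank (pathVertex a i)
  pathVertex-rank-strict (≼-child e a) {zero}  {suc j} _ =
    ℕP.≤-<-trans (pathVertex-rank≤ a j) (rank-dec _ _ e)
  pathVertex-rank-strict (≼-child e a) {suc i} {suc j} (s≤s i<j) =
    pathVertex-rank-strict a i<j

  -- Pigeonhole: ranks strictly decrease along a path, so its vertices are distinct.
  pathLength<n : ∀ {u v} (a : u ≼ v) → pathLength a < n
  pathLength<n a with n ℕP.≤? pathLength a
  ... | no  n≰ℓ = ℕP.≰⇒> n≰ℓ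
  ... | yes n≤ℓ with FinP.pigeonhole (s≤s n≤ℓ) (pathVertex a)
  ...   | i , j , i<j , same =
    ⊥-elim (ℕP.<-irrefl (cong rank (sym same)) (pathVertex-rank-strict a i<j))

  inSubAux-complete : ∀ {k u v} (a : u ≼ v) → pathLength a ≤ k → inSubAux k u v ≡ true
  inSubAux-complete {zero}  {u} ≼-refl _ = ⌊⌋-yes (u ≟ u) refl
  inSubAux-complete {suc k} {u} {v} a ℓ≤k with v ≟ u | parent v in pv
  ... | yes _ | _ = refl
  inSubAux-complete {suc k} ≼-refl _ | no u≢u | _ = ⊥-elim (u≢u refl)
  inSubAux-complete {suc k} (≼-child e a) (s≤s ℓ≤k) | no _ | just w
    rewrite just-injective (trans (sym pv) e) = inSubAux-complete a ℓ≤k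
  inSubAux-complete {suc k} (≼-child e a) _ | no _ | nothing = case trans (sym pv) e of λ ()

  inSubAux-sound : ∀ k {u v} → inSubAux k u v ≡ true → u ≼ v
  inSubAux-sound zero    {u} {v} h with v ≟ u
  ... | yes refl = ≼-refl
  inSubAux-sound (suc k) {u} {v} h with v ≟ u | parent v in pv
  ... | yes refl | _      = ≼-refl
  ... | no _     | just w = ≼-child pv (inSubAux-sound k h)

  ≼⇒inSubtree : ∀ {u v} → u ≼ v → inSubtree u v ≡ true
  ≼⇒inSubtree a = inSubAux-complete a (ℕP.<⇒≤ (pathLength<n a))

  inSubtree⇒≼ : ∀ {u v} → inSubtree u v ≡ true → u ≼ v
  inSubtree⇒≼ = inSubAux-sound n

  ⋠⇒inSubtree≡false : ∀ {u v} → ¬ u ≼ v → inSubtree u v ≡ false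
  ⋠⇒inSubtree≡false {u} {v} u⋠v with inSubtree u v in h
  ... | true  = ⊥-elim (u⋠v (inSubtree⇒≼ h))
  ... | false = refl

  inSubtree≡false⇒⋠ : ∀ {u v} → inSubtree u v ≡ false → ¬ u ≼ v
  inSubtree≡false⇒⋠ h a with trans (sym (≼⇒inSubtree a)) h
  ... | ()

  ≼-trans : ∀ {u v w} → u ≼ v → v ≼ w → u ≼ w
  ≼-trans a ≼-refl        = a
  ≼-trans a (≼-child e b) = ≼-child e (≼-trans a b)

  parent⇒≼ : ∀ {u v} → parent v ≡ just u → u ≼ v
  parent⇒≼ e = ≼-child e ≼-refl

  ≼-rank : ∀ {u v} → u ≼ v → rank u ≤ rank v
  ≼-rank ≼-refl        = ℕP.≤-refl
  ≼-rank (≼-child e a) = ℕP.<⇒≤ (ℕP.≤-<-trans (≼-rank a) (rank-dec _ _ e))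

  child⋠parent : ∀ {u v} → parent v ≡ just u → ¬ v ≼ u
  child⋠parent {u} {v} e a = ℕP.<-irrefl refl (ℕP.≤-<-trans (≼-rank a) (rank-dec u v e))

  child≢parent : ∀ {u v} → parent v ≡ just u → v ≢ u
  child≢parent e refl = child⋠parent e ≼-refl

  grandchild⋠grandparent : ∀ {u v w} → parent v ≡ just u → parent w ≡ just v → ¬ w ≼ u
  grandchild⋠grandparent pv pw w≼u = child⋠parent pv (≼-trans (parent⇒≼ pw) w≼u)

  ⋠⇒≢ : ∀ {v x} → ¬ v ≼ x → x ≢ v
  ⋠⇒≢ v⋠x refl = v⋠x ≼-refl

  root≼ : ∀ v → root ≼ v
  root≼ v = go v (<-wellFounded (rank v))
    where
    go : ∀ v → Acc _<_ (rank v) → root ≼ v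
    go v (acc rec) with parent v in pv
    ... | nothing = subst (root ≼_) (sym (Equivalence.to (isRoot v) pv)) ≼-refl
    ... | just u  = ≼-child pv (go u (rec (rank-dec u v pv)))

  ≼-total-below : ∀ {a b x} → a ≼ x → b ≼ x → a ≼ b ⊎ b ≼ a
  ≼-total-below ≼-refl        b≼x           = inj₂ b≼x
  ≼-total-below a≼x           ≼-refl        = inj₁ a≼x
  ≼-total-below (≼-child e a) (≼-child e′ b)
    rewrite just-injective (trans (sym e) e′) = ≼-total-below a b

  ≼-parent : ∀ {x v w} → parent w ≡ just v → x ≼ w → x ≢ w → x ≼ v
  ≼-parent e ≼-refl        x≢w = ⊥-elim (x≢w refl)
  ≼-parent e (≼-child e′ a) _ rewrite just-injective (trans (sym e) e′) = a

  child-on-path : ∀ {u x} → u ≼ x → x ≢ u → ∃ λ w → parent w ≡ just u × w ≼ x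
  child-on-path ≼-refl x≢u = ⊥-elim (x≢u refl)
  child-on-path {u} (≼-child {x} {y} e a) _ with y ≟ u
  ... | yes refl = x , e , ≼-refl
  ... | no y≢u with child-on-path a y≢u
  ...   | w , pw , w≼y = w , pw , ≼-child e w≼y

  siblings-disjoint : ∀ {u v w x} → parent v ≡ just u → parent w ≡ just u → v ≢ w →
                      v ≼ x → ¬ w ≼ x
  siblings-disjoint pv pw v≢w v≼x w≼x with ≼-total-below v≼x w≼x
  ... | inj₁ v≼w = child⋠parent pv (≼-parent pw v≼w v≢w)
  ... | inj₂ w≼v = child⋠parent pw (≼-parent pv w≼v (v≢w ∘ sym))

  inSubtree-child : ∀ {u v x} → parent v ≡ just u → x ≢ v → inSubtree x v ≡ inSubtree x u
  inSubtree-child {u} {v} {x} pv x≢v with inSubtree x u in h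
  ... | true  = ≼⇒inSubtree (≼-trans (inSubtree⇒≼ h) (parent⇒≼ pv))
  ... | false = ⋠⇒inSubtree≡false (λ x≼v → inSubtree≡false⇒⋠ h (≼-parent pv x≼v x≢v))

  parent⇒isChild : ∀ {u v} → parent v ≡ just u → isChild u v ≡ true
  parent⇒isChild {u} e rewrite e = ⌊⌋-yes (u ≟ u) refl

  isChild⇒parent : ∀ {u v} → isChild u v ≡ true → parent v ≡ just u
  isChild⇒parent {u} {v} h with parent v
  ... | just w = cong just (⌊⌋-witness (w ≟ u) h)

  parent⇒¬isChild : ∀ {u v} → parent v ≡ just u → isChild v u ≡ false
  parent⇒¬isChild {u} {v} e with isChild v u in h
  ... | true  = ⊥-elim (child⋠parent e (parent⇒≼ (isChild⇒parent h)))
  ... | false = refl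

  child≢root : ∀ {u v} → parent v ≡ just u → v ≢ root
  child≢root {u} {v} e v≡root with trans (sym e) (Equivalence.from (isRoot v) v≡root)
  ... | ()

Φ : ∀ {n} → (Fin n → ℤ) → ℕ
Φ d = ℕ∑.sum (λ x → ∣ d x ∣)

Φ-cong : ∀ {n} {d d′ : Fin n → ℤ} → (∀ x → d x ≡ d′ x) → Φ d ≡ Φ d′
Φ-cong d≗d′ = ℕ∑.sum-cong-≗ (cong ∣_∣ ∘ d≗d′)

Φ-zero : ∀ {n} {d : Fin n → ℤ} → (∀ x → d x ≡ + 0) → Φ d ≡ 0
Φ-zero {n} d≗0 = trans (Φ-cong d≗0) (ℕ∑.sum-replicate-zero n)

Φ-upd : ∀ {n} (d : Fin n → ℤ) v a → Φ (upd d v a) + ∣ d v ∣ ≡ Φ d + ∣ a ∣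
Φ-upd d v a = trans
  (ℕ∑.sum-except (λ x → ∣ upd d v a x ∣) (λ x → ∣ d x ∣) v (λ x x≢v → cong ∣_∣ (upd-other d v a x≢v)))
  (cong (λ z → Φ d + ∣ z ∣) (upd-same d v a))

Φ-upd-decrease : ∀ {n} (d : Fin n → ℤ) v a → ∣ d v ∣ ≡ suc ∣ a ∣ → suc (Φ (upd d v a)) ≡ Φ d
Φ-upd-decrease d v a shrinks = ℕP.+-cancelʳ-≡ ∣ a ∣ _ _ (begin
  suc (Φ (upd d v a)) + ∣ a ∣   ≡⟨ ℕP.+-suc (Φ (upd d v a)) ∣ a ∣ ⟨
  Φ (upd d v a) + suc ∣ a ∣     ≡⟨ cong (_+_ (Φ (upd d v a))) shrinks ⟨
  Φ (upd d v a) + ∣ d v ∣       ≡⟨ Φ-upd d v a ⟩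
  Φ d + ∣ a ∣                   ∎)
  where open ≡-Reasoning

Φ-upd-bound : ∀ {n} (d : Fin n → ℤ) v a → ∣ d v ∣ ≤ suc ∣ a ∣ → Φ d ≤ suc (Φ (upd d v a))
Φ-upd-bound d v a bounded = ℕP.+-cancelʳ-≤ ∣ a ∣ _ _ (begin
  Φ d + ∣ a ∣                   ≡⟨ Φ-upd d v a ⟨
  Φ (upd d v a) + ∣ d v ∣       ≤⟨ ℕP.+-monoʳ-≤ (Φ (upd d v a)) bounded ⟩
  Φ (upd d v a) + suc ∣ a ∣     ≡⟨ ℕP.+-suc (Φ (upd d v a)) ∣ a ∣ ⟩
  suc (Φ (upd d v a)) + ∣ a ∣   ∎)
  where open ℕP.≤-Reasoning

∣∣-pred : ∀ z → + 0 ℤ.< z → ∣ z ∣ ≡ suc ∣ z -ℤ + 1 ∣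
∣∣-pred (+ suc k)  _           = refl
∣∣-pred (+ zero)   (ℤ.+<+ ())
∣∣-pred ℤ.-[1+ k ] ()

∣∣-suc : ∀ z → z ℤ.< + 0 → ∣ z ∣ ≡ suc ∣ z +ℤ + 1 ∣
∣∣-suc ℤ.-[1+ zero  ] _ = refl
∣∣-suc ℤ.-[1+ suc k ] _ = refl
∣∣-suc (+ k)          (ℤ.+<+ ())

∣∣-pred-bound : ∀ z → ∣ z ∣ ≤ suc ∣ z -ℤ + 1 ∣
∣∣-pred-bound z = subst (_≤ suc ∣ z -ℤ + 1 ∣) (cong ∣_∣ (sub-add z))
  (ℕP.≤-trans (ℤP.∣i+j∣≤∣i∣+∣j∣ (z -ℤ + 1) (+ 1)) (ℕP.≤-reflexive (ℕP.+-comm _ 1)))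
  where
  sub-add : ∀ z → (z -ℤ + 1) +ℤ + 1 ≡ z
  sub-add = solve-∀

∣∣-suc-bound : ∀ z → ∣ z ∣ ≤ suc ∣ z +ℤ + 1 ∣
∣∣-suc-bound z = subst (_≤ suc ∣ z +ℤ + 1 ∣) (cong ∣_∣ (add-sub z))
  (ℕP.≤-trans (ℤP.∣i-j∣≤∣i∣+∣j∣ (z +ℤ + 1) (+ 1)) (ℕP.≤-reflexive (ℕP.+-comm _ 1)))
  where
  add-sub : ∀ z → (z +ℤ + 1) -ℤ + 1 ≡ z
  add-sub = solve-∀

module Demand {n : ℕ} (T : RootedTree n) (τ : Config n) where
  open RootedTree T
  open Tree T
  open Ancestry T

  subtreeSum : (Fin n → ℤ) → Fin n → ℤ
  subtreeSum E u = ℤ∑.sum (λ x → if inSubtree u x then E x else + 0)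

  childSum : (Fin n → ℤ) → Fin n → ℤ
  childSum f u = ℤ∑.sum (λ w → if isChild u w then f w else + 0)

  childSum-cong : ∀ {f g u} → (∀ w → f w ≡ g w) → childSum f u ≡ childSum g u
  childSum-cong {u = u} f≗g = ℤ∑.sum-cong-≗ (λ w → cong (if isChild u w then_else + 0) (f≗g w))

  module _ (E : Fin n → ℤ) (u : Fin n) where

    private
      inChild : Fin n → Fin n → ℤ
      inChild w x = if isChild u w then (if inSubtree w x then E x else + 0) else + 0

      inChild-vanishes : ∀ w x → (parent w ≡ just u → w ≼ x → ⊥) → inChild w x ≡ + 0
      inChild-vanishes w x no-path with isChild u w in c | inSubtree w x in i
      ... | true  | true  = ⊥-elim (no-path (isChild⇒parent c) (inSubtree⇒≼ i))
      ... | true  | false = refl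
      ... | false | _     = refl

      inChild-at-self : ℤ∑.sum (λ w → inChild w u) ≡ + 0
      inChild-at-self =
        trans (ℤ∑.sum-cong-≗ (λ w → inChild-vanishes w u child⋠parent)) (ℤ∑.sum-replicate-zero n)

      -- Every proper descendant x of u lies below exactly one child of u.
      inChild-below : ∀ x → x ≢ u → ℤ∑.sum (λ w → inChild w x) ≡ (if inSubtree u x then E x else + 0)
      inChild-below x x≢u with inSubtree u x in i
      ... | false = trans (ℤ∑.sum-cong-≗ (λ w → inChild-vanishes w x
                      (λ pw w≼x → inSubtree≡false⇒⋠ i (≼-trans (parent⇒≼ pw) w≼x))))
                      (ℤ∑.sum-replicate-zero n)
      ... | true with child-on-path (inSubtree⇒≼ i) x≢u
      ...   | w₀ , pw₀ , w₀≼x = trans (∑-single _ w₀ others) on-w₀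
        where
        others : ∀ w → w ≢ w₀ → inChild w x ≡ + 0
        others w w≢w₀ = inChild-vanishes w x (λ pw → siblings-disjoint pw₀ pw (w≢w₀ ∘ sym) w₀≼x)
        on-w₀ : inChild w₀ x ≡ E x
        on-w₀ rewrite parent⇒isChild pw₀ | ≼⇒inSubtree w₀≼x = refl

      sum-inChild : ∀ w → ℤ∑.sum (inChild w) ≡ (if isChild u w then subtreeSum E w else + 0)
      sum-inChild w with isChild u w
      ... | true  = refl
      ... | false = ℤ∑.sum-replicate-zero n

    subtreeSum-children : subtreeSum E u ≡ E u +ℤ childSum (subtreeSum E) u
    subtreeSum-children = begin
      subtreeSum E u
        ≡⟨ ℤP.+-identityʳ _ ⟨
      subtreeSum E u +ℤ + 0
        ≡⟨ cong (subtreeSum E u +ℤ_) inChild-at-self ⟨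
      subtreeSum E u +ℤ ℤ∑.sum (λ w → inChild w u)
        ≡⟨ ℤ∑.sum-except _ _ u (λ x x≢u → sym (inChild-below x x≢u)) ⟩
      ℤ∑.sum (λ x → ℤ∑.sum (λ w → inChild w x)) +ℤ (if inSubtree u u then E u else + 0)
        ≡⟨ cong₂ _+ℤ_ (sym (ℤ∑.∑-comm inChild)) (cong (if_then E u else + 0) (≼⇒inSubtree ≼-refl)) ⟩
      ℤ∑.sum (λ w → ℤ∑.sum (inChild w)) +ℤ E u
        ≡⟨ cong (_+ℤ E u) (ℤ∑.sum-cong-≗ sum-inChild) ⟩
      childSum (subtreeSum E) u +ℤ E u
        ≡⟨ ℤP.+-comm _ (E u) ⟩
      E u +ℤ childSum (subtreeSum E) u
        ∎
      where open ≡-Reasoning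

  localDemand : Config n → Fin n → ℤ
  localDemand p x = b2ℤ (τ x) -ℤ b2ℤ (p x)

  localDemand-occupied : ∀ p v → p v ≡ true → localDemand p v ℤ.≤ + 0
  localDemand-occupied p v pv rewrite pv with τ v
  ... | true  = ℤP.≤-refl
  ... | false = ℤ.-≤+

  localDemand-vacant : ∀ p v → p v ≡ false → + 0 ℤ.≤ localDemand p v
  localDemand-vacant p v pv rewrite pv with τ v
  ... | true  = ℤ.+≤+ ℕ.z≤n
  ... | false = ℤP.≤-refl

  demand≡subtreeSum : ∀ p u → demand p τ u ≡ subtreeSum (localDemand p) u
  demand≡subtreeSum p u = foldr-map-allFin _+ℤ_ (+ 0) {n} _

  demand-children : ∀ p u → demand p τ u ≡ localDemand p u +ℤ childSum (demand p τ) u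
  demand-children p u = begin
    demand p τ u                                            ≡⟨ demand≡subtreeSum p u ⟩
    subtreeSum (localDemand p) u                            ≡⟨ subtreeSum-children (localDemand p) u ⟩
    localDemand p u +ℤ childSum (subtreeSum (localDemand p)) u
      ≡⟨ cong (localDemand p u +ℤ_) (childSum-cong (λ w → sym (demand≡subtreeSum p w))) ⟩
    localDemand p u +ℤ childSum (demand p τ) u              ∎
    where open ≡-Reasoning

  demand-upd : ∀ p y b x → demand (upd p y b) τ x
                           ≡ demand p τ x +ℤ (if inSubtree x y then b2ℤ (p y) -ℤ b2ℤ b else + 0)
  demand-upd p y b x = unshift (inSubtree x y) {d = demand p τ x} {b2ℤ (τ y)} {b2ℤ (p y)} {b2ℤ b} (begin
    demand (upd p y b) τ x +ℤ masked p y
      ≡⟨ cong (_+ℤ masked p y) (demand≡subtreeSum (upd p y b) x) ⟩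
    subtreeSum (localDemand (upd p y b)) x +ℤ masked p y
      ≡⟨ ℤ∑.sum-except (masked (upd p y b)) (masked p) y agree ⟩
    subtreeSum (localDemand p) x +ℤ masked (upd p y b) y
      ≡⟨ cong₂ _+ℤ_ (sym (demand≡subtreeSum p x)) (cong (masked-at y) (upd-same p y b)) ⟩
    demand p τ x +ℤ masked-at y b
      ∎)
    where
    open ≡-Reasoning
    masked-at : Fin n → Bool → ℤ
    masked-at z c = if inSubtree x z then b2ℤ (τ z) -ℤ b2ℤ c else + 0
    masked : Config n → Fin n → ℤ
    masked q z = masked-at z (q z)
    agree : ∀ z → z ≢ y → masked (upd p y b) z ≡ masked p z
    agree z z≢y = cong (masked-at z) (upd-other p y b z≢y)
    unshift : ∀ c {d′ d t old new} →
              d′ +ℤ (if c then t -ℤ old else + 0) ≡ d +ℤ (if c then t -ℤ new else + 0) →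
              d′ ≡ d +ℤ (if c then old -ℤ new else + 0)
    unshift true {d′} {d} {t} {old} {new} eq = begin
      d′                                   ≡⟨ add-sub d′ (t -ℤ old) ⟩
      (d′ +ℤ (t -ℤ old)) -ℤ (t -ℤ old)     ≡⟨ cong (_-ℤ (t -ℤ old)) eq ⟩
      (d +ℤ (t -ℤ new)) -ℤ (t -ℤ old)      ≡⟨ regroup d t old new ⟩
      d +ℤ (old -ℤ new)                    ∎
      where
      add-sub : ∀ a x → a ≡ (a +ℤ x) -ℤ x
      add-sub = solve-∀
      regroup : ∀ d t old new → (d +ℤ (t -ℤ new)) -ℤ (t -ℤ old) ≡ d +ℤ (old -ℤ new)
      regroup = solve-∀
    unshift false {d′} eq = trans (sym (ℤP.+-identityʳ d′)) eq

  demand-applyMove : ∀ p {a b} → a ≢ b → p a ≡ true → p b ≡ false → ∀ x →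
    demand (applyMove p (a , b)) τ x ≡ (demand p τ x +ℤ b2ℤ (inSubtree x a)) -ℤ b2ℤ (inSubtree x b)
  demand-applyMove p {a} {b} a≢b pa pb x
    rewrite demand-upd (upd p a false) b true x | demand-upd p a false x
          | upd-other p a false (a≢b ∘ sym) | pa | pb
    with inSubtree x a | inSubtree x b
  ... | true  | true  = refl
  ... | true  | false = refl
  ... | false | true  = refl
  ... | false | false = refl

  private
    add-sub : ∀ d c → (d +ℤ c) -ℤ c ≡ d
    add-sub = solve-∀

  demand-moveDown : ∀ p {u v} → parent v ≡ just u → p u ≡ true → p v ≡ false →
    ∀ x → demand (applyMove p (u , v)) τ x ≡ upd (demand p τ) v (demand p τ v -ℤ + 1) x
  demand-moveDown p {u} {v} pv pu pv₀ x
    rewrite demand-applyMove p (child≢parent pv ∘ sym) pu pv₀ x with x ≟ v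
  ... | yes refl rewrite ≼⇒inSubtree (≼-refl {x}) | ⋠⇒inSubtree≡false (child⋠parent pv) =
    cong (_-ℤ + 1) (ℤP.+-identityʳ (demand p τ x))
  ... | no x≢v rewrite inSubtree-child pv x≢v = add-sub _ _

  demand-moveUp : ∀ p {u v} → parent v ≡ just u → p v ≡ true → p u ≡ false →
    ∀ x → demand (applyMove p (v , u)) τ x ≡ upd (demand p τ) v (demand p τ v +ℤ + 1) x
  demand-moveUp p {u} {v} pv pv₁ pu x
    rewrite demand-applyMove p (child≢parent pv) pv₁ pu x with x ≟ v
  ... | yes refl rewrite ≼⇒inSubtree (≼-refl {x}) | ⋠⇒inSubtree≡false (child⋠parent pv) =
    ℤP.+-identityʳ (demand p τ x +ℤ + 1)
  ... | no x≢v rewrite inSubtree-child pv x≢v = add-sub _ _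

  count-as-sum : ∀ (c : Config n) → + count c ≡ ℤ∑.sum (λ x → b2ℤ (c x))
  count-as-sum c = trans (cong +_ (foldr-map-allFin _+_ 0 {n} _)) (pos-sum {n} _)

  demand-root : ∀ p → demand p τ root ≡ ℤ∑.sum (localDemand p)
  demand-root p = trans (demand≡subtreeSum p root)
    (ℤ∑.sum-cong-≗ (λ x → cong (if_then localDemand p x else + 0) (≼⇒inSubtree (root≼ x))))

  demand-root-balanced : ∀ p → count p ≡ count τ → demand p τ root ≡ + 0
  demand-root-balanced p balanced = identityˡ-unique (demand p τ root) (+ count p) (begin
    demand p τ root +ℤ + count p
      ≡⟨ cong₂ _+ℤ_ (demand-root p) (count-as-sum p) ⟩
    ℤ∑.sum (localDemand p) +ℤ ℤ∑.sum (λ x → b2ℤ (p x))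
      ≡⟨ ℤ∑.∑-distrib-+ {n} (localDemand p) (λ x → b2ℤ (p x)) ⟨
    ℤ∑.sum (λ x → localDemand p x +ℤ b2ℤ (p x))
      ≡⟨ ℤ∑.sum-cong-≗ (λ x → sub-add (b2ℤ (τ x)) (b2ℤ (p x))) ⟩
    ℤ∑.sum (λ x → b2ℤ (τ x))
      ≡⟨ count-as-sum τ ⟨
    + count τ
      ≡⟨ cong +_ balanced ⟨
    + count p
      ∎)
    where
    open ≡-Reasoning
    sub-add : ∀ t c → (t -ℤ c) +ℤ c ≡ t
    sub-add = solve-∀

  private
    if-zero : ∀ c → (if c then + 0 else + 0) ≡ + 0
    if-zero true  = refl
    if-zero false = refl

  localDemand≡0 : ∀ p x → localDemand p x ≡ + 0 → p x ≡ τ x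
  localDemand≡0 p x h with τ x | p x
  ... | true  | true  = refl
  ... | false | false = refl

  demand≗0⇒onTarget : ∀ p → (∀ x → demand p τ x ≡ + 0) → ∀ x → p x ≡ τ x
  demand≗0⇒onTarget p balanced x = localDemand≡0 p x (begin
    localDemand p x                             ≡⟨ ℤP.+-identityʳ _ ⟨
    localDemand p x +ℤ + 0                      ≡⟨ cong (localDemand p x +ℤ_) no-children ⟨
    localDemand p x +ℤ childSum (demand p τ) x  ≡⟨ demand-children p x ⟨
    demand p τ x                                ≡⟨ balanced x ⟩
    + 0                                         ∎)
    where
    open ≡-Reasoning
    no-children : childSum (demand p τ) x ≡ + 0
    no-children = trans (childSum-cong balanced)
      (trans (ℤ∑.sum-cong-≗ (λ w → if-zero (isChild x w))) (ℤ∑.sum-replicate-zero n))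

  -- The local demands are ≥ 0 and sum to the root demand, so they all vanish.
  onTargets⇒demand≗0 : ∀ c → (∀ v → c v ≡ true → τ v ≡ true) → demand c τ root ≡ + 0 →
                       ∀ x → demand c τ x ≡ + 0
  onTargets⇒demand≗0 c c⊆τ root-balanced x = trans (demand≡subtreeSum c x)
    (trans (ℤ∑.sum-cong-≗ (λ z → trans (cong (if inSubtree x z then_else + 0) (local≡0 z))
                                        (if-zero (inSubtree x z))))
           (ℤ∑.sum-replicate-zero n))
    where
    local≥0 : ∀ z → + 0 ℤ.≤ localDemand c z
    local≥0 z with c z in cz | τ z in τz
    ... | true  | true  = ℤP.≤-refl
    ... | true  | false = case trans (sym (c⊆τ z cz)) τz of λ ()
    ... | false | true  = ℤ.+≤+ ℕ.z≤n
    ... | false | false = ℤP.≤-refl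
    local≡0 : ∀ z → localDemand c z ≡ + 0
    local≡0 z with localDemand c z ℤ.≟ + 0
    ... | yes local≡0 = local≡0
    ... | no  local≢0 =
      ⊥-elim (ℤP.<-irrefl (trans (sym root-balanced) (demand-root c)) (∑-pos local≥0 z local≢0))

  totalDemand≡Φ : ∀ p → totalDemand p τ ≡ Φ (demand p τ)
  totalDemand≡Φ p = foldr-map-allFin _+_ 0 {n} _

  edgeMove-step : ∀ p p′ {u v} a → parent v ≡ just u →
    (∀ x → demand p′ τ x ≡ upd (demand p τ) v a x) → ∣ demand p τ v ∣ ≤ suc ∣ a ∣ →
    totalDemand p τ ≤ suc (totalDemand p′ τ) × demand p′ τ root ≡ demand p τ root
  edgeMove-step p p′ {v = v} a pv moved bounded = bound , root-fixed
    where
    bound : totalDemand p τ ≤ suc (totalDemand p′ τ)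
    bound = subst₂ (λ t t′ → t ≤ suc t′) (sym (totalDemand≡Φ p))
                   (trans (Φ-cong (sym ∘ moved)) (sym (totalDemand≡Φ p′)))
                   (Φ-upd-bound (demand p τ) v a bounded)
    root-fixed : demand p′ τ root ≡ demand p τ root
    root-fixed = trans (moved root) (upd-other (demand p τ) v a (child≢root pv ∘ sym))

  validMove-step : ∀ p a b → validMove p (a , b) ≡ true →
    totalDemand p τ ≤ suc (totalDemand (applyMove p (a , b)) τ)
    × demand (applyMove p (a , b)) τ root ≡ demand p τ root
  validMove-step p a b valid with ∧-elim valid
  ... | adjacent , movable with ∧-elim movable | ∨-elim adjacent
  ...   | pa , vacant | inj₁ down = edgeMove-step p (applyMove p (a , b)) _ (isChild⇒parent down)
    (demand-moveDown p (isChild⇒parent down) pa (not≡true vacant)) (∣∣-pred-bound (demand p τ b))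
  ...   | pa , vacant | inj₂ up   = edgeMove-step p (applyMove p (a , b)) _ (isChild⇒parent up)
    (demand-moveUp p (isChild⇒parent up) pa (not≡true vacant)) (∣∣-suc-bound (demand p τ a))

  lowerBound : ∀ plan p {c} → exec p plan ≡ just c → (∀ v → c v ≡ true → τ v ≡ true) →
               demand p τ root ≡ + 0 → totalDemand p τ ≤ length plan
  lowerBound [] p refl c⊆τ balanced =
    ℕP.≤-reflexive (trans (totalDemand≡Φ p) (Φ-zero (onTargets⇒demand≗0 p c⊆τ balanced)))
  lowerBound ((a , b) ∷ plan) p ran c⊆τ balanced with validMove p (a , b) in valid
  ... | true with validMove-step p a b valid
  ...   | bound , root-fixed = ℕP.≤-trans bound
    (s≤s (lowerBound plan (applyMove p (a , b)) ran c⊆τ (trans root-fixed balanced)))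

module Algorithm {n : ℕ} (T : RootedTree n) (p₀ τ : Config n) (σ : Tree.Scheduler T) where
  open RootedTree T
  open Tree T
  open St
  open Ancestry T
  open Demand T τ

  record Consistent (p : Config n) (d : Fin n → ℤ) (plan : Plan n) : Set where
    field
      tracks   : ∀ x → d x ≡ demand p τ x
      reaches  : exec p₀ plan ≡ just p
      accounts : length plan + Φ d ≡ totalDemand p₀ τ
  open Consistent

  -- Defined from the fields, so that it is insensitive to the choice counter cnt.
  Invariant : St → Set
  Invariant s = Consistent (pe s) (de s) (out s)

  Terminates : (ℕ → Maybe St) → (St → Set) → Set
  Terminates go P = ∃ λ s′ → P s′ × ∃ λ f₀ → ∀ f → f₀ ≤ f → go f ≡ just s′

  Terminates-step : ∀ {go go′ P} → (∀ f → go (suc f) ≡ go′ f) → Terminates go′ P → Terminates go P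
  Terminates-step unfold (s′ , p , f₀ , stable) =
    s′ , p , suc f₀ , λ { (suc f) f₀<f → trans (unfold f) (stable f (ℕ.s≤s⁻¹ f₀<f)) }

  Terminates-bind : ∀ {go : ℕ → Maybe St} {k : ℕ → St → Maybe St} {P Q} →
    Terminates go P → (∀ s → P s → Terminates (λ f → k f s) Q) → Terminates (λ f → go f >>= k f) Q
  Terminates-bind {k = k} (s₁ , p , f₁ , stable₁) continue with continue s₁ p
  ... | s₂ , q , f₂ , stable₂ = s₂ , q , f₁ ⊔ f₂ , λ f bound →
    trans (cong (_>>= k f) (stable₁ f (ℕP.m⊔n≤o⇒m≤o f₁ f₂ bound))) (stable₂ f (ℕP.m⊔n≤o⇒n≤o f₁ f₂ bound))

  Terminates-map : ∀ {go P Q} → (∀ {s} → P s → Q s) → Terminates go P → Terminates go Q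
  Terminates-map P⇒Q (s′ , p , f₀ , stable) = s′ , P⇒Q p , f₀ , stable

  Terminates-just : ∀ {s P} → P s → Terminates (λ _ → just s) P
  Terminates-just p = _ , p , 0 , λ _ _ → refl

  exec-snoc : ∀ c xs {c′} m → exec c xs ≡ just c′ → validMove c′ m ≡ true →
              exec c (xs ++ [ m ]) ≡ just (applyMove c′ m)
  exec-snoc c []       m refl    valid rewrite valid = refl
  exec-snoc c (x ∷ xs) m reaches valid with validMove c x
  ... | true = exec-snoc (applyMove c x) xs m reaches valid

  move-invariant : ∀ s a b v (shift : ℤ → ℤ) → Invariant s → validMove (pe s) (a , b) ≡ true →
    de (movePebble a b s) ≡ upd (de s) v (shift (de s v)) →
    (∀ x → demand (applyMove (pe s) (a , b)) τ x
           ≡ upd (demand (pe s) τ) v (shift (demand (pe s) τ v)) x) →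
    ∣ de s v ∣ ≡ suc ∣ shift (de s v) ∣ →
    Invariant (movePebble a b s) × suc (Φ (de (movePebble a b s))) ≡ Φ (de s)
  move-invariant s a b v shift inv valid de-moved demand-moved shrinks = inv′ , decrease
    where
    decrease : suc (Φ (de (movePebble a b s))) ≡ Φ (de s)
    decrease = trans (cong (suc ∘ Φ) de-moved) (Φ-upd-decrease (de s) v _ shrinks)
    inv′ : Invariant (movePebble a b s)
    inv′ = record
      { tracks   = λ x → trans (cong (λ d → d x) de-moved)
                     (trans (upd-cong v (tracks inv) (cong shift (tracks inv v)) x)
                            (sym (demand-moved x)))
      ; reaches  = exec-snoc p₀ (out s) (a , b) (reaches inv) valid
      ; accounts = begin
          length (out s ++ [ (a , b) ]) + Φ (de (movePebble a b s))
            ≡⟨ cong (_+ Φ (de (movePebble a b s))) (trans (length-++ (out s)) (ℕP.+-comm _ 1)) ⟩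
          suc (length (out s)) + Φ (de (movePebble a b s))
            ≡⟨ ℕP.+-suc (length (out s)) _ ⟨
          length (out s) + suc (Φ (de (movePebble a b s)))
            ≡⟨ cong (_+_ (length (out s))) decrease ⟩
          length (out s) + Φ (de s)
            ≡⟨ accounts inv ⟩
          totalDemand p₀ τ ∎
      }
      where open ≡-Reasoning

  de-moveDown : ∀ s {u v} → parent v ≡ just u → de (movePebble u v s) ≡ upd (de s) v (de s v -ℤ + 1)
  de-moveDown s pv rewrite parent⇒isChild pv = refl

  de-moveUp : ∀ s {u v} → parent v ≡ just u → de (movePebble v u s) ≡ upd (de s) v (de s v +ℤ + 1)
  de-moveUp s pv rewrite parent⇒¬isChild pv = refl

  pe-move-from : ∀ s {a b} → a ≢ b → pe (movePebble a b s) a ≡ false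
  pe-move-from s {a} {b} a≢b =
    trans (upd-other (upd (pe s) a false) b true a≢b) (upd-same (pe s) a false)

  pe-move-to : ∀ s {a b} → pe (movePebble a b s) b ≡ true
  pe-move-to s {a} {b} = upd-same (upd (pe s) a false) b true

  pe-move-other : ∀ s {a b x} → x ≢ a → x ≢ b → pe (movePebble a b s) x ≡ pe s x
  pe-move-other s {a} {b} x≢a x≢b =
    trans (upd-other (upd (pe s) a false) b true x≢b) (upd-other (pe s) a false x≢a)

  moveDown-invariant : ∀ s {u v} → Invariant s → parent v ≡ just u →
    pe s u ≡ true → pe s v ≡ false → + 0 ℤ.< de s v →
    Invariant (movePebble u v s) × suc (Φ (de (movePebble u v s))) ≡ Φ (de s)
  moveDown-invariant s {u} {v} inv pv pu pv₀ 0<dv =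
    move-invariant s u v v (_-ℤ + 1) inv valid (de-moveDown s pv)
      (demand-moveDown (pe s) pv pu pv₀) (∣∣-pred (de s v) 0<dv)
    where
    valid : validMove (pe s) (u , v) ≡ true
    valid rewrite parent⇒isChild pv | pu | pv₀ = refl

  moveUp-invariant : ∀ s {u v} → Invariant s → parent v ≡ just u →
    pe s v ≡ true → pe s u ≡ false → de s v ℤ.< + 0 →
    Invariant (movePebble v u s) × suc (Φ (de (movePebble v u s))) ≡ Φ (de s)
  moveUp-invariant s {u} {v} inv pv pv₁ pu dv<0 =
    move-invariant s v u v (_+ℤ + 1) inv valid (de-moveUp s pv)
      (demand-moveUp (pe s) pv pv₁ pu) (∣∣-suc (de s v) dv<0)
    where
    valid : validMove (pe s) (v , u) ≡ true
    valid rewrite parent⇒¬isChild pv | parent⇒isChild pv | pv₁ | pu = refl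

  firstSat-sound : ∀ (c : Fin n → Bool) xs {w} → firstSat c xs ≡ just w → c w ≡ true
  firstSat-sound c (x ∷ xs) h with c x in cx
  firstSat-sound c (x ∷ xs) refl | true  = cx
  ...                            | false = firstSat-sound c xs h

  firstSat-nothing : ∀ (c : Fin n → Bool) {xs w} → firstSat c xs ≡ nothing → w ∈ xs → c w ≡ false
  firstSat-nothing c {x ∷ xs} h w∈ with c x in cx
  firstSat-nothing c {x ∷ xs} h (here refl) | false = cx
  firstSat-nothing c {x ∷ xs} h (there w∈)  | false = firstSat-nothing c h w∈

  pick-spec : ∀ (c : Fin n → Bool) s → (∃ λ w → c w ≡ true) →
    ∃ λ w → c w ≡ true × pick σ c s ≡ just (w , record s { cnt = suc (cnt s) })
  pick-spec c s (w₀ , cw₀) with c (σ (cnt s)) in cσ | firstSat c (allFin n) in first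
  ... | true  | _       = σ (cnt s) , cσ , refl
  ... | false | just w  = w , firstSat-sound c (allFin n) first , refl
  ... | false | nothing = case trans (sym cw₀) (firstSat-nothing c first (∈-allFin w₀)) of λ ()

  de-split : ∀ s → Invariant s → ∀ v → de s v ≡ localDemand (pe s) v +ℤ childSum (de s) v
  de-split s inv v = trans (tracks inv v) (trans (demand-children (pe s) v)
    (cong (localDemand (pe s) v +ℤ_) (childSum-cong (sym ∘ tracks inv))))

  childTerm : St → Fin n → Fin n → ℤ
  childTerm s v w = if isChild v w then de s w else + 0

  childTerm-child : ∀ s {v w} → isChild v w ≡ true → childTerm s v w ≡ de s w
  childTerm-child s c rewrite c = refl

  positive-childTerm : ∀ s v w → + 0 ℤ.< childTerm s v w → (isChild v w ∧ pos (de s w)) ≡ true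
  positive-childTerm s v w 0<t with isChild v w
  ... | true  = ⌊⌋-yes (+ 0 ℤ.<? de s w) 0<t
  ... | false = ⊥-elim (ℤP.<-irrefl refl 0<t)

  negative-childTerm : ∀ s v w → childTerm s v w ℤ.< + 0 → (isChild v w ∧ neg (de s w)) ≡ true
  negative-childTerm s v w t<0 with isChild v w
  ... | true  = ⌊⌋-yes (de s w ℤ.<? + 0) t<0
  ... | false = ⊥-elim (ℤP.<-irrefl refl t<0)

  inject-candidate : ∀ s {v} → Invariant s → pe s v ≡ true → + 0 ℤ.< de s v →
                     ∃ λ w → (isChild v w ∧ pos (de s w)) ≡ true
  inject-candidate s {v} inv occupied 0<dv with positive-summand (childTerm s v) no-positive
    where
    no-positive : ¬ (∀ w → childTerm s v w ℤ.≤ + 0)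
    no-positive t≤0 = ℤP.<-irrefl refl (ℤP.<-≤-trans 0<dv (ℤP.≤-trans (ℤP.≤-reflexive (de-split s inv v))
      (ℤP.+-mono-≤ (localDemand-occupied (pe s) v occupied) (∑-nonpos t≤0))))
  ... | w , 0<t = w , positive-childTerm s v w 0<t

  extract-candidate : ∀ s {v} → Invariant s → pe s v ≡ false → de s v ℤ.< + 0 →
                      ∃ λ w → (isChild v w ∧ neg (de s w)) ≡ true
  extract-candidate s {v} inv vacant dv<0 with negative-summand (childTerm s v) no-negative
    where
    no-negative : ¬ (∀ w → + 0 ℤ.≤ childTerm s v w)
    no-negative 0≤t = ℤP.<-irrefl refl (ℤP.≤-<-trans (ℤP.≤-trans
      (ℤP.+-mono-≤ (localDemand-vacant (pe s) v vacant) (∑-nonneg 0≤t))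
      (ℤP.≤-reflexive (sym (de-split s inv v)))) dv<0)
  ... | w , t<0 = w , negative-childTerm s v w t<0

  balance-candidate⁺ : ∀ s {u y} → Invariant s → de s u ≡ + 0 → isChild u y ≡ true → de s y ≢ + 0 →
                       pe s u ≡ true → ∃ λ w → (isChild u w ∧ pos (de s w)) ≡ true
  balance-candidate⁺ s {u} {y} inv du cy dy≢0 occupied with positive-summand (childTerm s u) no-positive
    where
    no-positive : ¬ (∀ w → childTerm s u w ℤ.≤ + 0)
    no-positive t≤0 = ℤP.<-irrefl du (ℤP.≤-<-trans (ℤP.≤-reflexive (de-split s inv u))
      (ℤP.+-mono-≤-< (localDemand-occupied (pe s) u occupied)
                     (∑-neg t≤0 y (dy≢0 ∘ trans (sym (childTerm-child s cy))))))
  ... | w , 0<t = w , positive-childTerm s u w 0<t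

  balance-candidate⁻ : ∀ s {u y} → Invariant s → de s u ≡ + 0 → isChild u y ≡ true → de s y ≢ + 0 →
                       pe s u ≡ false → ∃ λ w → (isChild u w ∧ neg (de s w)) ≡ true
  balance-candidate⁻ s {u} {y} inv du cy dy≢0 vacant with negative-summand (childTerm s u) no-negative
    where
    no-negative : ¬ (∀ w → + 0 ℤ.≤ childTerm s u w)
    no-negative 0≤t = ℤP.<-irrefl (sym du) (ℤP.<-≤-trans
      (ℤP.+-mono-≤-< (localDemand-vacant (pe s) u vacant)
                     (∑-pos 0≤t y (dy≢0 ∘ trans (sym (childTerm-child s cy)))))
      (ℤP.≤-reflexive (sym (de-split s inv u))))
  ... | w , t<0 = w , negative-childTerm s u w t<0

  -- parent v reappears inside movePebble u v once inject has unfolded, hence the second rewrite.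
  inject-vacant : ∀ f s {u v} → parent v ≡ just u → pe s v ≡ false →
                  inject σ (suc f) v s ≡ just (movePebble u v s)
  inject-vacant f s pv vacant rewrite pv | pv | vacant = refl

  inject-occupied : ∀ f s {u v w s₁} → parent v ≡ just u → pe s v ≡ true →
    pick σ (λ w → isChild v w ∧ pos (de s w)) s ≡ just (w , s₁) →
    inject σ (suc f) v s ≡ (inject σ f w s₁ >>= λ s₂ → just (movePebble u v s₂))
  inject-occupied f s pv occupied picked rewrite pv | occupied | picked | pv = refl

  extract-occupied : ∀ f s {u v} → parent v ≡ just u → pe s v ≡ true →
                     extract σ (suc f) v s ≡ just (movePebble v u s)
  extract-occupied f s pv occupied rewrite pv | occupied = refl

  extract-vacant : ∀ f s {u v w s₁} → parent v ≡ just u → pe s v ≡ false →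
    pick σ (λ w → isChild v w ∧ neg (de s w)) s ≡ just (w , s₁) →
    extract σ (suc f) v s ≡ (extract σ f w s₁ >>= λ s₂ → just (movePebble v u s₂))
  extract-vacant f s pv vacant picked rewrite pv | vacant | picked = refl

  record ChangedWithin (v : Fin n) (s s′ : St) : Set where
    field
      Φ-nonincreasing : Φ (de s′) ≤ Φ (de s)
      de-outside      : ∀ x → ¬ v ≼ x → de s′ x ≡ de s x
      pe-outside      : ∀ x → ¬ v ≼ x → pe s′ x ≡ pe s x

  ChangedWithin-refl : ∀ {v s} → ChangedWithin v s s
  ChangedWithin-refl = record
    { Φ-nonincreasing = ℕP.≤-refl ; de-outside = λ _ _ → refl ; pe-outside = λ _ _ → refl }

  -- The outcome of inject (b = false) or extract (b = true) at v, whose parent is u.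
  record Transferred (u v : Fin n) (s s′ : St) (b : Bool) : Set where
    field
      invariant   : Invariant s′
      Φ-decreases : Φ (de s′) < Φ (de s)
      de-outside  : ∀ x → ¬ v ≼ x → de s′ x ≡ de s x
      pe-outside  : ∀ x → ¬ v ≼ x → x ≢ u → pe s′ x ≡ pe s x
      pe-parent   : pe s′ u ≡ b

  transferred-within : ∀ {v w s s′ b k} → parent w ≡ just v →
                       Transferred v w (record s { cnt = k }) s′ b → ChangedWithin v s s′
  transferred-within pw R = record
    { Φ-nonincreasing = ℕP.<⇒≤ (Transferred.Φ-decreases R)
    ; de-outside      = λ x v⋠x → Transferred.de-outside R x (below v⋠x)
    ; pe-outside      = λ x v⋠x → Transferred.pe-outside R x (below v⋠x) (⋠⇒≢ v⋠x)
    }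
    where
    below : ∀ {x} → ¬ _ ≼ x → ¬ _ ≼ x
    below v⋠x w≼x = v⋠x (≼-trans (parent⇒≼ pw) w≼x)

  inject-last-move : ∀ {u v s s₂} → parent v ≡ just u → Invariant s₂ → ChangedWithin v s s₂ →
    pe s₂ u ≡ true → pe s₂ v ≡ false → + 0 ℤ.< de s₂ v → Transferred u v s (movePebble u v s₂) false
  inject-last-move {u} {v} {s} {s₂} pv inv W pu pv₀ 0<dv = record
    { invariant   = proj₁ moved
    ; Φ-decreases = ℕP.≤-trans (ℕP.≤-reflexive (proj₂ moved)) (ChangedWithin.Φ-nonincreasing W)
    ; de-outside  = λ x v⋠x → trans (cong (λ d → d x) (de-moveDown s₂ pv))
                                (trans (upd-other (de s₂) v (de s₂ v -ℤ + 1) (⋠⇒≢ v⋠x))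
                                       (ChangedWithin.de-outside W x v⋠x))
    ; pe-outside  = λ x v⋠x x≢u → trans (pe-move-other s₂ x≢u (⋠⇒≢ v⋠x))
                                         (ChangedWithin.pe-outside W x v⋠x)
    ; pe-parent   = pe-move-from s₂ (child≢parent pv ∘ sym)
    }
    where
    moved : Invariant (movePebble u v s₂) × suc (Φ (de (movePebble u v s₂))) ≡ Φ (de s₂)
    moved = moveDown-invariant s₂ inv pv pu pv₀ 0<dv

  extract-last-move : ∀ {u v s s₂} → parent v ≡ just u → Invariant s₂ → ChangedWithin v s s₂ →
    pe s₂ v ≡ true → pe s₂ u ≡ false → de s₂ v ℤ.< + 0 → Transferred u v s (movePebble v u s₂) true
  extract-last-move {u} {v} {s} {s₂} pv inv W pv₁ pu dv<0 = record
    { invariant   = proj₁ moved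
    ; Φ-decreases = ℕP.≤-trans (ℕP.≤-reflexive (proj₂ moved)) (ChangedWithin.Φ-nonincreasing W)
    ; de-outside  = λ x v⋠x → trans (cong (λ d → d x) (de-moveUp s₂ pv))
                                (trans (upd-other (de s₂) v (de s₂ v +ℤ + 1) (⋠⇒≢ v⋠x))
                                       (ChangedWithin.de-outside W x v⋠x))
    ; pe-outside  = λ x v⋠x x≢u → trans (pe-move-other s₂ (⋠⇒≢ v⋠x) x≢u)
                                         (ChangedWithin.pe-outside W x v⋠x)
    ; pe-parent   = pe-move-to s₂ {v} {u}
    }
    where
    moved : Invariant (movePebble v u s₂) × suc (Φ (de (movePebble v u s₂))) ≡ Φ (de s₂)
    moved = moveUp-invariant s₂ inv pv pv₁ pu dv<0

  private
    depth-exhausted : ∀ {v} (a : root ≼ v) → ¬ (n ≤ pathLength a + 0)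
    depth-exhausted a deep =
      ℕP.<⇒≱ (pathLength<n a) (ℕP.≤-trans deep (ℕP.≤-reflexive (ℕP.+-identityʳ _)))

    deeper : ∀ {v w} (a : root ≼ v) (pw : parent w ≡ just v) h →
             n ≤ pathLength a + suc h → n ≤ pathLength (≼-child pw a) + h
    deeper a pw h deep = ℕP.≤-trans deep (ℕP.≤-reflexive (ℕP.+-suc (pathLength a) h))

  -- h is fuel for the descent: paths from the root have length < n (pathLength<n).
  inject-terminates : ∀ h {u v} (a : root ≼ v) → n ≤ pathLength a + h → parent v ≡ just u →
    ∀ s → Invariant s → pe s u ≡ true → + 0 ℤ.< de s v →
    Terminates (λ f → inject σ f v s) (λ s′ → Transferred u v s s′ false)
  inject-terminates h {u} {v} a deep pv s inv pu 0<dv with pe s v in occupancy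
  ... | false = Terminates-step (λ f → inject-vacant f s pv occupancy)
                  (Terminates-just (inject-last-move pv inv ChangedWithin-refl pu occupancy 0<dv))
  ... | true with h
  ...   | zero = ⊥-elim (depth-exhausted a deep)
  ...   | suc h′ with pick-spec _ s (inject-candidate s inv occupancy 0<dv)
  ...     | w , cw , picked with ∧-elim cw
  ...       | child , positive =
    Terminates-step (λ f → inject-occupied f s pv occupancy picked)
      (Terminates-bind (inject-terminates h′ (≼-child pw a) (deeper a pw h′ deep) pw _ inv occupancy
                          (⌊⌋-witness (+ 0 ℤ.<? de s w) positive))
        (λ s₂ R → Terminates-just (inject-last-move pv
          (Transferred.invariant R) (transferred-within pw R)
          (trans (Transferred.pe-outside R u (grandchild⋠grandparent pv pw) (child≢parent pv ∘ sym)) pu)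
          (Transferred.pe-parent R)
          (subst (+ 0 ℤ.<_) (sym (Transferred.de-outside R v (child⋠parent pw))) 0<dv))))
    where
    pw : parent w ≡ just v
    pw = isChild⇒parent child

  extract-terminates : ∀ h {u v} (a : root ≼ v) → n ≤ pathLength a + h → parent v ≡ just u →
    ∀ s → Invariant s → pe s u ≡ false → de s v ℤ.< + 0 →
    Terminates (λ f → extract σ f v s) (λ s′ → Transferred u v s s′ true)
  extract-terminates h {u} {v} a deep pv s inv pu dv<0 with pe s v in occupancy
  ... | true = Terminates-step (λ f → extract-occupied f s pv occupancy)
                 (Terminates-just (extract-last-move pv inv ChangedWithin-refl occupancy pu dv<0))
  ... | false with h
  ...   | zero = ⊥-elim (depth-exhausted a deep)
  ...   | suc h′ with pick-spec _ s (extract-candidate s inv occupancy dv<0)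
  ...     | w , cw , picked with ∧-elim cw
  ...       | child , negative =
    Terminates-step (λ f → extract-vacant f s pv occupancy picked)
      (Terminates-bind (extract-terminates h′ (≼-child pw a) (deeper a pw h′ deep) pw _ inv occupancy
                          (⌊⌋-witness (de s w ℤ.<? + 0) negative))
        (λ s₂ R → Terminates-just (extract-last-move pv
          (Transferred.invariant R) (transferred-within pw R)
          (Transferred.pe-parent R)
          (trans (Transferred.pe-outside R u (grandchild⋠grandparent pv pw) (child≢parent pv ∘ sym)) pu)
          (subst (ℤ._< + 0) (sym (Transferred.de-outside R v (child⋠parent pw))) dv<0))))
    where
    pw : parent w ≡ just v
    pw = isChild⇒parent child

  nz-sound : ∀ x → nz x ≡ true → x ≢ + 0
  nz-sound x h with x ℤ.≟ + 0
  ... | no x≢0 = x≢0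

  nz-complete : ∀ x → nz x ≡ false → x ≡ + 0
  nz-complete x h with x ℤ.≟ + 0
  ... | yes x≡0 = x≡0

  unbalancedChild : St → Fin n → Fin n → Bool
  unbalancedChild s u v = isChild u v ∧ nz (de s v)

  balWhile-done : ∀ f u s → any (unbalancedChild s u) (allFin n) ≡ false →
                  balWhile σ (suc f) u s ≡ just s
  balWhile-done f u s none rewrite none = refl

  balWhile-inject : ∀ f u s {v s₁} → any (unbalancedChild s u) (allFin n) ≡ true → pe s u ≡ true →
    pick σ (λ v → isChild u v ∧ pos (de s v)) s ≡ just (v , s₁) →
    balWhile σ (suc f) u s ≡ (inject σ f v s₁ >>= balWhile σ f u)
  balWhile-inject f u s some occupied picked rewrite some | occupied | picked = refl

  balWhile-extract : ∀ f u s {v s₁} → any (unbalancedChild s u) (allFin n) ≡ true → pe s u ≡ false →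
    pick σ (λ v → isChild u v ∧ neg (de s v)) s ≡ just (v , s₁) →
    balWhile σ (suc f) u s ≡ (extract σ f v s₁ >>= balWhile σ f u)
  balWhile-extract f u s some vacant picked rewrite some | vacant | picked = refl

  record ChildrenBalanced (u : Fin n) (s s′ : St) : Set where
    field
      invariant     : Invariant s′
      children-zero : ∀ w → isChild u w ≡ true → de s′ w ≡ + 0
      de-outside    : ∀ x → ¬ u ≼ x → de s′ x ≡ de s x
      de-self       : de s′ u ≡ de s u

  balWhile-terminates : ∀ k u s → Invariant s → de s u ≡ + 0 → Φ (de s) ≤ k →
                        Terminates (λ f → balWhile σ f u s) (ChildrenBalanced u s)

  -- Φ drops with every pass, so k bounds the number of passes.
  balWhile-continue : ∀ k u s {v s₂ b c} → de s u ≡ + 0 → Φ (de s) ≤ k → parent v ≡ just u →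
    Transferred u v (record s { cnt = c }) s₂ b →
    Terminates (λ f → balWhile σ f u s₂) (ChildrenBalanced u s)
  balWhile-continue zero u s du bound pv R =
    ⊥-elim (ℕP.n≮0 (ℕP.<-≤-trans (Transferred.Φ-decreases R) bound))
  balWhile-continue (suc k) u s {s₂ = s₂} du bound pv R =
    Terminates-map compose (balWhile-terminates k u s₂ (Transferred.invariant R) du₂
      (ℕ.s≤s⁻¹ (ℕP.<-≤-trans (Transferred.Φ-decreases R) bound)))
    where
    du₂ : de s₂ u ≡ + 0
    du₂ = trans (Transferred.de-outside R u (child⋠parent pv)) du
    compose : ∀ {s₃} → ChildrenBalanced u s₂ s₃ → ChildrenBalanced u s s₃
    compose C = record
      { invariant     = ChildrenBalanced.invariant C
      ; children-zero = ChildrenBalanced.children-zero C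
      ; de-outside    = λ x u⋠x → trans (ChildrenBalanced.de-outside C x u⋠x)
                          (Transferred.de-outside R x (λ v≼x → u⋠x (≼-trans (parent⇒≼ pv) v≼x)))
      ; de-self       = trans (ChildrenBalanced.de-self C) (Transferred.de-outside R u (child⋠parent pv))
      }

  balWhile-terminates k u s inv du bound with any (unbalancedChild s u) (allFin n) in unbalanced
  ... | false = Terminates-step (λ f → balWhile-done f u s unbalanced) (Terminates-just balanced)
    where
    balanced : ChildrenBalanced u s s
    balanced = record
      { invariant     = inv
      ; children-zero = λ w cw → nz-complete (de s w)
                          (subst (λ c → c ∧ nz (de s w) ≡ false) cw (any-false _ unbalanced w))
      ; de-outside    = λ _ _ → refl
      ; de-self       = refl
      }
  ... | true with any-witness _ unbalanced
  ...   | y , cy with ∧-elim cy | pe s u in occupancy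
  ...     | child-y , nz-y | true
    with pick-spec _ s (balance-candidate⁺ s inv du child-y (nz-sound (de s y) nz-y) occupancy)
  ...       | v , cv , picked with ∧-elim cv
  ...         | cv′ , positive =
    Terminates-step (λ f → balWhile-inject f u s unbalanced occupancy picked)
      (Terminates-bind (inject-terminates n (≼-child pv (root≼ u)) (ℕP.m≤n+m n _) pv _ inv occupancy
                          (⌊⌋-witness (+ 0 ℤ.<? de s v) positive))
                       (λ s₂ R → balWhile-continue k u s du bound pv R))
    where
    pv : parent v ≡ just u
    pv = isChild⇒parent cv′
  balWhile-terminates k u s inv du bound | true | y , cy | child-y , nz-y | false
    with pick-spec _ s (balance-candidate⁻ s inv du child-y (nz-sound (de s y) nz-y) occupancy)
  ...       | v , cv , picked with ∧-elim cv
  ...         | cv′ , negative =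
    Terminates-step (λ f → balWhile-extract f u s unbalanced occupancy picked)
      (Terminates-bind (extract-terminates n (≼-child pv (root≼ u)) (ℕP.m≤n+m n _) pv _ inv occupancy
                          (⌊⌋-witness (de s v ℤ.<? + 0) negative))
                       (λ s₂ R → balWhile-continue k u s du bound pv R))
    where
    pv : parent v ≡ just u
    pv = isChild⇒parent cv′

  record SubtreeBalanced (u : Fin n) (s s′ : St) : Set where
    field
      invariant  : Invariant s′
      de-inside  : ∀ x → u ≼ x → de s′ x ≡ + 0
      de-outside : ∀ x → ¬ u ≼ x → de s′ x ≡ de s x

  BalanceTerminatesAtChildren : Fin n → Set
  BalanceTerminatesAtChildren u = ∀ {w} → parent w ≡ just u → ∀ s → Invariant s → de s w ≡ + 0 →
                                  Terminates (λ f → balance σ f w s) (SubtreeBalanced w s)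

  record ChildLoop (u : Fin n) (s₀ : St) (done : Config n) (s : St) : Set where
    field
      invariant     : Invariant s
      de-outside    : ∀ x → ¬ u ≼ x → de s x ≡ de s₀ x
      de-self       : de s u ≡ + 0
      children-zero : ∀ w → isChild u w ≡ true → de s w ≡ + 0
      done-balanced : ∀ w → isChild u w ≡ true → done w ≡ true → ∀ x → w ≼ x → de s x ≡ + 0

  pending : Config n → ℕ
  pending done = ℕ∑.sum (λ x → b2ℕ (not (done x)))

  pending-mark : ∀ done v → done v ≡ false → suc (pending (upd done v true)) ≡ pending done
  pending-mark done v fresh = begin
    suc (pending marked)                   ≡⟨ ℕP.+-comm 1 _ ⟩
    pending marked + b2ℕ (not false)       ≡⟨ cong (λ b → pending marked + b2ℕ (not b)) fresh ⟨
    pending marked + b2ℕ (not (done v))    ≡⟨ ℕ∑.sum-except _ _ v unchanged ⟩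
    pending done + b2ℕ (not (marked v))    ≡⟨ cong (λ b → pending done + b2ℕ (not b)) (upd-same done v true) ⟩
    pending done + 0                       ≡⟨ ℕP.+-identityʳ _ ⟩
    pending done                           ∎
    where
    open ≡-Reasoning
    marked : Config n
    marked = upd done v true
    unchanged : ∀ x → x ≢ v → b2ℕ (not (marked x)) ≡ b2ℕ (not (done x))
    unchanged x x≢v = cong (b2ℕ ∘ not) (upd-other done v true x≢v)

  unfinishedChild : Fin n → Config n → Fin n → Bool
  unfinishedChild u done v = isChild u v ∧ not (done v)

  balChildren-done : ∀ f u done s → any (unfinishedChild u done) (allFin n) ≡ false →
                     balChildren σ (suc f) u done s ≡ just s
  balChildren-done f u done s none rewrite none = refl

  balChildren-next : ∀ f u done s {v s₁} → any (unfinishedChild u done) (allFin n) ≡ true →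
    pick σ (unfinishedChild u done) s ≡ just (v , s₁) →
    balChildren σ (suc f) u done s ≡ (balance σ f v s₁ >>= balChildren σ f u (upd done v true))
  balChildren-next f u done s some picked rewrite some | picked = refl

  ChildLoop-start : ∀ {u s s₁} → de s u ≡ + 0 → ChildrenBalanced u s s₁ → ChildLoop u s (λ _ → false) s₁
  ChildLoop-start du C = record
    { invariant     = ChildrenBalanced.invariant C
    ; de-outside    = ChildrenBalanced.de-outside C
    ; de-self       = trans (ChildrenBalanced.de-self C) du
    ; children-zero = ChildrenBalanced.children-zero C
    ; done-balanced = λ _ _ ()
    }

  ChildLoop-step : ∀ {u v s₀ done s s₂ c} → parent v ≡ just u → ChildLoop u s₀ done s →
    SubtreeBalanced v (record s { cnt = c }) s₂ → ChildLoop u s₀ (upd done v true) s₂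
  ChildLoop-step {u} {v} {done = done} {s₂ = s₂} pv L B = record
    { invariant     = SubtreeBalanced.invariant B
    ; de-outside    = λ x u⋠x →
        trans (SubtreeBalanced.de-outside B x (λ v≼x → u⋠x (≼-trans (parent⇒≼ pv) v≼x)))
              (ChildLoop.de-outside L x u⋠x)
    ; de-self       = trans (SubtreeBalanced.de-outside B u (child⋠parent pv)) (ChildLoop.de-self L)
    ; children-zero = children-zero
    ; done-balanced = done-balanced
    }
    where
    children-zero : ∀ w → isChild u w ≡ true → de s₂ w ≡ + 0
    children-zero w cw with w ≟ v
    ... | yes refl = SubtreeBalanced.de-inside B w ≼-refl
    ... | no  w≢v  =
      trans (SubtreeBalanced.de-outside B w (siblings-disjoint (isChild⇒parent cw) pv w≢v ≼-refl))
            (ChildLoop.children-zero L w cw)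
    done-balanced : ∀ w → isChild u w ≡ true → upd done v true w ≡ true → ∀ x → w ≼ x → de s₂ x ≡ + 0
    done-balanced w cw dw x w≼x with w ≟ v
    ... | yes refl = SubtreeBalanced.de-inside B x w≼x
    ... | no  w≢v  =
      trans (SubtreeBalanced.de-outside B x (siblings-disjoint (isChild⇒parent cw) pv w≢v w≼x))
            (ChildLoop.done-balanced L w cw dw x w≼x)

  ChildLoop-finish : ∀ {u s₀ done s} → ChildLoop u s₀ done s →
                     any (unfinishedChild u done) (allFin n) ≡ false → SubtreeBalanced u s₀ s
  ChildLoop-finish {u} {done = done} {s} L none = record
    { invariant  = ChildLoop.invariant L
    ; de-inside  = de-inside
    ; de-outside = ChildLoop.de-outside L
    }
    where
    finished : ∀ w → isChild u w ≡ true → done w ≡ true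
    finished w cw with done w | any-false _ none w
    ... | true  | _ = refl
    ... | false | h = case trans (sym h) (cong (_∧ true) cw) of λ ()
    de-inside : ∀ x → u ≼ x → de s x ≡ + 0
    de-inside x u≼x with x ≟ u
    ... | yes refl = ChildLoop.de-self L
    ... | no  x≢u with child-on-path u≼x x≢u
    ...   | w , pw , w≼x =
      ChildLoop.done-balanced L w (parent⇒isChild pw) (finished w (parent⇒isChild pw)) x w≼x

  balChildren-terminates : ∀ m u → BalanceTerminatesAtChildren u → ∀ s₀ done s → pending done ≤ m →
    ChildLoop u s₀ done s → Terminates (λ f → balChildren σ f u done s) (SubtreeBalanced u s₀)
  balChildren-terminates m u IH s₀ done s bound L
    with any (unfinishedChild u done) (allFin n) in remaining
  ... | false = Terminates-step (λ f → balChildren-done f u done s remaining)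
                  (Terminates-just (ChildLoop-finish L remaining))
  ... | true with pick-spec _ s (any-witness _ remaining)
  ...   | v , cv , picked with ∧-elim cv
  ...     | child , unfinished = continue m bound
    where
    pv : parent v ≡ just u
    pv = isChild⇒parent child
    shrinks : suc (pending (upd done v true)) ≡ pending done
    shrinks = pending-mark done v (not≡true unfinished)
    continue : ∀ k → pending done ≤ k →
               Terminates (λ f → balChildren σ f u done s) (SubtreeBalanced u s₀)
    continue zero     bound′ = case subst (_≤ 0) (sym shrinks) bound′ of λ ()
    continue (suc m′) bound′ =
      Terminates-step (λ f → balChildren-next f u done s remaining picked)
        (Terminates-bind (IH pv _ (ChildLoop.invariant L) (ChildLoop.children-zero L v child))
          (λ s₂ B → balChildren-terminates m′ u IH s₀ (upd done v true) s₂
                      (ℕ.s≤s⁻¹ (subst (_≤ suc m′) (sym shrinks) bound′)) (ChildLoop-step pv L B)))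

  balance-terminates : ∀ h {u} (a : root ≼ u) → n ≤ pathLength a + h → ∀ s → Invariant s → de s u ≡ + 0 →
                       Terminates (λ f → balance σ f u s) (SubtreeBalanced u s)
  balance-terminates zero    a deep _ _ _ = ⊥-elim (depth-exhausted a deep)
  balance-terminates (suc h) {u} a deep s inv du =
    Terminates-step (λ f → refl)
      (Terminates-bind (balWhile-terminates (Φ (de s)) u s inv du ℕP.≤-refl)
        (λ s₁ C → balChildren-terminates _ u below s (λ _ → false) s₁ ℕP.≤-refl (ChildLoop-start du C)))
    where
    below : BalanceTerminatesAtChildren u
    below pw = balance-terminates h (≼-child pw a) (deeper a pw h deep)

module Correctness {n : ℕ} (T : RootedTree n) (p₀ τ : Config n) (balanced : count p₀ ≡ count τ) where
  open RootedTree T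
  open Tree T
  open Ancestry T
  open Demand T τ

  root-balanced : demand p₀ τ root ≡ + 0
  root-balanced = demand-root-balanced p₀ balanced

  module _ (σ : Scheduler) where
    open Algorithm T p₀ τ σ

    run-terminates : Terminates (run p₀ τ σ) (SubtreeBalanced root (initSt p₀ τ))
    run-terminates = balance-terminates n ≼-refl (ℕP.m≤n+m n 0) (initSt p₀ τ) initial root-balanced
      where
      initial : Invariant (initSt p₀ τ)
      initial = record { tracks = λ _ → refl ; reaches = refl ; accounts = sym (totalDemand≡Φ p₀) }

    balanced-outcome : ∀ {s} → SubtreeBalanced root (initSt p₀ τ) s →
                       Feasible p₀ τ (St.out s) × length (St.out s) ≡ totalDemand p₀ τ
    balanced-outcome {s} B = (St.pe s , Consistent.reaches inv , on-target) , length≡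
      where
      inv : Invariant s
      inv = SubtreeBalanced.invariant B
      zero-demand : ∀ x → St.de s x ≡ + 0
      zero-demand x = SubtreeBalanced.de-inside B x (root≼ x)
      on-target : ∀ v → St.pe s v ≡ true → τ v ≡ true
      on-target v occupied = trans (sym (demand≗0⇒onTarget (St.pe s)
        (λ x → trans (sym (Consistent.tracks inv x)) (zero-demand x)) v)) occupied
      length≡ : length (St.out s) ≡ totalDemand p₀ τ
      length≡ = begin
        length (St.out s)                    ≡⟨ ℕP.+-identityʳ _ ⟨
        length (St.out s) + 0                ≡⟨ cong (_+_ (length (St.out s))) (Φ-zero zero-demand) ⟨
        length (St.out s) + Φ (St.de s)      ≡⟨ Consistent.accounts inv ⟩
        totalDemand p₀ τ                     ∎
        where open ≡-Reasoning

  algorithm-correct : ∀ σ → Σ ℕ λ fuel → Σ St λ s →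
    run p₀ τ σ fuel ≡ just s × Feasible p₀ τ (St.out s) × length (St.out s) ≡ totalDemand p₀ τ
  algorithm-correct σ with run-terminates σ
  ... | s , B , fuel , stable = fuel , s , stable fuel ℕP.≤-refl , balanced-outcome σ B

  optimal : IsOPT p₀ τ (totalDemand p₀ τ)
  optimal with algorithm-correct (λ _ → root)
  ... | _ , s , _ , feasible , length≡ =
    (St.out s , feasible , length≡) ,
    λ { plan (_ , reaches , on-targets) → lowerBound plan p₀ reaches on-targets root-balanced }

mainTheorem3 : ∀ {n} (T : RootedTree n) (p₀ τ : Config n) → count p₀ ≡ count τ →
    let open Tree T in
    (∀ (σ : Scheduler) → Σ ℕ λ fuel → Σ St λ s →
        run p₀ τ σ fuel ≡ just s
        × Feasible p₀ τ (St.out s)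
        × length (St.out s) ≡ totalDemand p₀ τ)
    × IsOPT p₀ τ (totalDemand p₀ τ)
mainTheorem3 T p₀ τ balanced = algorithm-correct , optimal
  where open Correctness T p₀ τ balanced
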